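{- Let $D,D'$ be minimal ASDs. Then $D\equiv D'$ if and only if there exist bijections $\phi:\mathcal{S}_D\to\mathcal{S}_{D'}$ and $\alpha:\mathcal{P}_D\to\mathcal{P}_{D'}$ such that $\pi=\alpha(\pi)\circ\phi$ for all $\pi\in\mathcal{P}_D$, or, equivalently, $\pi'=\alpha^{ -1}(\pi')\circ\phi^{ -1}$ for all $\pi'\in\mathcal{P}_{D'}$.
   Context: An ASD is a pair $D=(\mathcal{S}_D,\mathcal{P}_D)$ with $\mathcal{S}_D$ a finite set and $\mathcal{P}_D$ a finite family of set partitions of $\mathcal{S}_D$. For partitions, $\pi\preceq\pi'$ means every block of $\pi$ lies in a block of $\pi'$. For $\phi:\mathcal{S}\to\mathcal{S}'$ and a partition $\pi$ of $\mathcal{S}'$, $\pi\circ\phi$ is the partition of $\mathcal{S}$ where $x,y$ share a block iff $\phi(x),\phi(y)$ share a block of $\pi$. $D\le D'$ means there exist $\phi:\mathcal{S}_D\to\mathcal{S}_{D'}$, $\alpha:\mathcal{P}_D\to\mathcal{P}_{D'}$ with $\alpha(\pi)\circ\phi\preceq\pi$ for all $\pi\in\mathcal{P}_D$; $D\equiv D'$ means $D\le D'$ and $D'\le D$. $D$ is state-minimal if no $D'\equiv D$ has $|\mathcal{S}_{D'}|<|\mathcal{S}_D|$, partition-minimal if no $D'\equiv D$ has $|\mathcal{P}_{D'}|<|\mathcal{P}_D|$, and minimal if both. -}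

module Defs where

open import Data.Nat using (ℕ; _<_)
open import Data.Fin using (Fin)
open import Data.Product using (Σ; _×_)
open import Relation.Binary.PropositionalEquality using (_≡_)
open import Relation.Nullary using (¬_)
open import Function using (_∘_; _⇔_)

-- A set partition of the finite set Fin n, given by a block labelling:
-- x and y lie in the same block iff they carry the same label.
-- Two labellings represent the same partition iff they induce the same
-- "same block" relation (see _≐_ below).
Partition : ℕ → Set
Partition n = Fin n → ℕ

SameBlock : ∀ {n} → Partition n → Fin n → Fin n → Set
SameBlock π x y = π x ≡ π y

_⪯_ : ∀ {n} → Partition n → Partition n → Set
π ⪯ π' = ∀ x y → SameBlock π x y → SameBlock π' x y

_≐_ : ∀ {n} → Partition n → Partition n → Set
π ≐ π' = ∀ x y → SameBlock π x y ⇔ SameBlock π' x y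

_∘ₚ_ : ∀ {n n'} → Partition n' → (Fin n → Fin n') → Partition n
π ∘ₚ φ = π ∘ φ

-- An ASD: state set S = Fin nS, finite family of partitions indexed by Fin nP.
record ASD : Set where
  field
    nS   : ℕ
    nP   : ℕ
    part : Fin nP → Partition nS
open ASD public

_≤D_ : ASD → ASD → Set
D ≤D D' = Σ (Fin (nS D) → Fin (nS D')) λ φ →
          Σ (Fin (nP D) → Fin (nP D')) λ α →
          ∀ i → (part D' (α i) ∘ₚ φ) ⪯ part D i

_≡D_ : ASD → ASD → Set
D ≡D D' = (D ≤D D') × (D' ≤D D)

StateMinimal : ASD → Set
StateMinimal D = ∀ D' → D' ≡D D → ¬ (nS D' < nS D)

PartitionMinimal : ASD → Set
PartitionMinimal D = ∀ D' → D' ≡D D → ¬ (nP D' < nP D)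

Minimal : ASD → Set
Minimal D = StateMinimal D × PartitionMinimal D

module Submission where

-- Suppose D ≡D D' via (φ, α) : D ≤D D' and (ψ, β) : D' ≤D D, with D and D'
-- minimal.
--   * Every map of an inequality into a minimal ASD is surjective: if φ
--     (resp. α) missed a point, it would factor through a strictly smaller
--     restriction of D' that is still equivalent to D', contradicting
--     minimality.  (Sections 1-2.)
--   * Two surjections between finite sets in opposite directions are
--     bijections, so φ and α are bijections; likewise ψ and β.  (Section 1.)
--   * Weigh a partition by the number of ordered pairs of states lying in a
--     common block.  This weight is monotone under refinement, invariant under
--     relabelling states by a bijection, and a refinement of equal weight is
--     an equality.  Summing over the family, (φ, α) and (ψ, β) show that the
--     total weights of D and D' agree, which forces every refinement
--     part D' (α i) ∘ φ ⪯ part D i to be an equality.  (Section 3.)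
-- The converse direction and the equivalence of the two formulations of the
-- isomorphism condition (through α, φ or through their inverses) are direct.
-- (Section 4.)

open import Defs
open import Data.Fin using (Fin)
open import Data.Product using (Σ; _×_)
open import Function using (_⇔_)
open import Function.Bundles using (_↔_; Inverse)

open import Data.Empty using (⊥-elim)
open import Data.Fin using (zero; suc; punchIn; punchOut)
open import Data.Fin.Properties using (any?; punchIn-punchOut; injective⇒≤)
  renaming (_≟_ to _≟ᶠ_)
open import Data.Nat using (ℕ; zero; suc; _+_; _≤_; _<_; z≤n)
open import Data.Nat.Properties
  using (+-0-commutativeMonoid; ≤-refl; ≤-trans; ≤-reflexive; +-mono-≤; +-monoˡ-≤; +-monoʳ-≤;
         +-cancelʳ-≤; +-cancelˡ-≤; n<1+n; 1+n≰n)
  renaming (_≟_ to _≟ⁿ_)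
open import Data.Product using (∃; _,_; proj₁; proj₂)
open import Data.Sum using (_⊎_; inj₁; inj₂)
open import Function using (_∘_; id; mk⇔; Equivalence)
open import Function.Bundles using (mk⤖)
open import Function.Consequences.Propositional using (strictlySurjective⇒surjective)
open import Function.Construct.Symmetry using (↔-sym; ⇔-sym)
open import Function.Definitions using (Injective; StrictlySurjective)
open import Function.Properties.Bijection using (⤖⇒↔)
open import Relation.Binary.PropositionalEquality
  using (_≡_; _≢_; sym; trans; cong; subst; module ≡-Reasoning)
open import Relation.Nullary using (Dec; yes; no)
open import Algebra.Properties.CommutativeMonoid.Sum +-0-commutativeMonoid
  using (sum; sum-cong-≗; sum-permute)

-- Section 1.  Maps between finite sets.

FactorsThrough : ∀ {m n} (k : ℕ) → (Fin m → Fin n) → Set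
FactorsThrough {m} {n} k f =
  Σ (Fin k → Fin n) λ ι → Σ (Fin m → Fin k) λ g → ∀ x → ι (g x) ≡ f x

hit-or-factors : ∀ {m n} (f : Fin m → Fin n) (y : Fin n) →
  (∃ λ x → f x ≡ y) ⊎ (∃ λ k → k < n × FactorsThrough k f)
hit-or-factors {n = suc k} f y with any? (λ x → f x ≟ᶠ y)
... | yes hit = inj₁ hit
... | no miss = inj₂ (k , n<1+n k , punchIn y , punchOut ∘ y≢f , punchIn-punchOut ∘ y≢f)
  where
  y≢f : ∀ x → y ≢ f x
  y≢f x eq = miss (x , sym eq)

-- Pigeonhole: an injection Fin m → Fin n with n ≤ m is surjective, since a
-- missed point would make it factor injectively through some Fin k, k < n.
injective⇒strictlySurjective : ∀ {m n} {f : Fin m → Fin n} →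
  Injective _≡_ _≡_ f → n ≤ m → StrictlySurjective _≡_ f
injective⇒strictlySurjective {f = f} f-inj n≤m y with hit-or-factors f y
... | inj₁ hit = hit
... | inj₂ (k , k<n , ι , g , ι∘g≗f) =
  ⊥-elim (1+n≰n (≤-trans k<n (≤-trans n≤m (injective⇒≤ g-inj))))
  where
  g-inj : Injective _≡_ _≡_ g
  g-inj {x} {x'} eq = f-inj (trans (sym (ι∘g≗f x)) (trans (cong ι eq) (ι∘g≗f x')))

section : ∀ {m n} {f : Fin m → Fin n} → StrictlySurjective _≡_ f → Fin n → Fin m
section surj = proj₁ ∘ surj

section-injective : ∀ {m n} {f : Fin m → Fin n} (surj : StrictlySurjective _≡_ f) →
  Injective _≡_ _≡_ (section surj)
section-injective {f = f} surj {y} {y'} eq =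
  trans (sym (proj₂ (surj y))) (trans (cong f eq) (proj₂ (surj y')))

surjective⇒≥ : ∀ {m n} {f : Fin m → Fin n} → StrictlySurjective _≡_ f → n ≤ m
surjective⇒≥ surj = injective⇒≤ (section-injective surj)

-- A surjection Fin m → Fin n with m ≤ n is injective: its section is then
-- surjective too, so every point is the chosen preimage of its image.
surjective⇒injective : ∀ {m n} {f : Fin m → Fin n} →
  StrictlySurjective _≡_ f → m ≤ n → Injective _≡_ _≡_ f
surjective⇒injective {f = f} surj m≤n {x} {x'} fx≡fx' = begin
  x        ≡⟨ sym (preimage-of x) ⟩
  s (f x)  ≡⟨ cong s fx≡fx' ⟩
  s (f x') ≡⟨ preimage-of x' ⟩
  x'       ∎
  where
  open ≡-Reasoning
  s = section surj
  s-surj = injective⇒strictlySurjective (section-injective surj) m≤n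
  preimage-of : ∀ x → s (f x) ≡ x
  preimage-of x with s-surj x
  ... | z , sz≡x = trans (cong (s ∘ f) (sym sz≡x)) (trans (cong s (proj₂ (surj z))) sz≡x)

-- Surjections in both directions between finite sets are bijections; the
-- forward map of the resulting bijection is f itself.
surjections⇒↔ : ∀ {m n} (f : Fin m → Fin n) → StrictlySurjective _≡_ f →
  (g : Fin n → Fin m) → StrictlySurjective _≡_ g → Fin m ↔ Fin n
surjections⇒↔ f f-surj g g-surj = ⤖⇒↔ (mk⤖ {to = f}
  (surjective⇒injective f-surj (surjective⇒≥ g-surj) , strictlySurjective⇒surjective f-surj))

-- Section 2.  Minimality forces the maps of an equivalence to be surjective.

≤D-trans : ∀ {D₁ D₂ D₃} → D₁ ≤D D₂ → D₂ ≤D D₃ → D₁ ≤D D₃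
≤D-trans (φ₁ , α₁ , p₁) (φ₂ , α₂ , p₂) =
  φ₂ ∘ φ₁ , α₂ ∘ α₁ , λ i x y e → p₁ i x y (p₂ (α₁ i) (φ₁ x) (φ₁ y) e)

restrictStates : ∀ {k} (D : ASD) → (Fin k → Fin (nS D)) → ASD
restrictStates {k} D ι = record { nS = k ; nP = nP D ; part = λ i → part D i ∘ₚ ι }

restrictPartitions : ∀ {k} (D : ASD) → (Fin k → Fin (nP D)) → ASD
restrictPartitions {k} D ι = record { nS = nS D ; nP = k ; part = part D ∘ ι }

restrictStates-≤D : ∀ {k} D (ι : Fin k → Fin (nS D)) → restrictStates D ι ≤D D
restrictStates-≤D D ι = ι , id , λ _ _ _ e → e

restrictPartitions-≤D : ∀ {k} D (ι : Fin k → Fin (nP D)) → restrictPartitions D ι ≤D D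
restrictPartitions-≤D D ι = id , ι , λ _ _ _ e → e

≤D-restrictStates : ∀ {k} {E D} ((φ , α , p) : E ≤D D) (ι : Fin k → Fin (nS D)) →
  (g : Fin (nS E) → Fin k) → (∀ x → ι (g x) ≡ φ x) → E ≤D restrictStates D ι
≤D-restrictStates {D = D} (φ , α , p) ι g ι∘g≗φ = g , α , λ i x y e →
  p i x y (trans (cong (part D (α i)) (sym (ι∘g≗φ x))) (trans e (cong (part D (α i)) (ι∘g≗φ y))))

≤D-restrictPartitions : ∀ {k} {E D} ((φ , α , p) : E ≤D D) (ι : Fin k → Fin (nP D)) →
  (g : Fin (nP E) → Fin k) → (∀ i → ι (g i) ≡ α i) → E ≤D restrictPartitions D ι
≤D-restrictPartitions {D = D} (φ , α , p) ι g ι∘g≗α = φ , g , λ i x y e →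
  p i x y (subst (λ j → part D j (φ x) ≡ part D j (φ y)) (ι∘g≗α i) e)

-- If E ≡D D and D is state-minimal, the state map of E ≤D D is surjective:
-- otherwise it factors through a smaller restriction of D, still ≡D to D.
stateMinimal⇒surjective : ∀ {E D} → StateMinimal D → (le : E ≤D D) → D ≤D E →
  StrictlySurjective _≡_ (proj₁ le)
stateMinimal⇒surjective {E} {D} min le ge y with hit-or-factors (proj₁ le) y
... | inj₁ hit = hit
... | inj₂ (k , k<nS , ι , g , ι∘g≗φ) =
  ⊥-elim (min D↾ (restrictStates-≤D D ι , D≤D↾) k<nS)
  where
  D↾ : ASD
  D↾ = restrictStates D ι
  D≤D↾ : D ≤D D↾
  D≤D↾ = ≤D-trans {D} {E} {D↾} ge (≤D-restrictStates {E = E} {D} le ι g ι∘g≗φ)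

partitionMinimal⇒surjective : ∀ {E D} → PartitionMinimal D → (le : E ≤D D) → D ≤D E →
  StrictlySurjective _≡_ (proj₁ (proj₂ le))
partitionMinimal⇒surjective {E} {D} min le ge y with hit-or-factors (proj₁ (proj₂ le)) y
... | inj₁ hit = hit
... | inj₂ (k , k<nP , ι , g , ι∘g≗α) =
  ⊥-elim (min D↾ (restrictPartitions-≤D D ι , D≤D↾) k<nP)
  where
  D↾ : ASD
  D↾ = restrictPartitions D ι
  D≤D↾ : D ≤D D↾
  D≤D↾ = ≤D-trans {D} {E} {D↾} ge (≤D-restrictPartitions {E = E} {D} le ι g ι∘g≗α)

-- Section 3.  Counting pairs of states in a common block.

indicator : ∀ {P : Set} → Dec P → ℕ
indicator (yes _) = 1
indicator (no _)  = 0

indicator-mono : ∀ {P Q : Set} (p? : Dec P) (q? : Dec Q) → (P → Q) → indicator p? ≤ indicator q?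
indicator-mono (yes _) (yes _) _   = ≤-refl
indicator-mono (yes p) (no ¬q) P→Q = ⊥-elim (¬q (P→Q p))
indicator-mono (no _)  _       _   = z≤n

indicator-reflects : ∀ {P Q : Set} (p? : Dec P) (q? : Dec Q) → indicator p? ≤ indicator q? → P → Q
indicator-reflects _       (yes q) _  _ = q
indicator-reflects (yes _) (no _)  ()
indicator-reflects (no ¬p) (no _)  _  p = ⊥-elim (¬p p)

sum-mono : ∀ {n} {f g : Fin n → ℕ} → (∀ i → f i ≤ g i) → sum f ≤ sum g
sum-mono {zero}  _   = z≤n
sum-mono {suc n} f≤g = +-mono-≤ (f≤g zero) (sum-mono (f≤g ∘ suc))

+-rigid : ∀ {a b c d} → a ≤ c → b ≤ d → c + d ≤ a + b → c ≤ a × d ≤ b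
+-rigid {a} {b} {c} {d} a≤c b≤d c+d≤a+b =
  +-cancelʳ-≤ d c a (≤-trans c+d≤a+b (+-monoʳ-≤ a b≤d)) ,
  +-cancelˡ-≤ c d b (≤-trans c+d≤a+b (+-monoˡ-≤ b a≤c))

sum-rigid : ∀ {n} {f g : Fin n → ℕ} → (∀ i → f i ≤ g i) → sum g ≤ sum f → ∀ i → g i ≤ f i
sum-rigid {suc n} f≤g Σg≤Σf i with +-rigid (f≤g zero) (sum-mono (f≤g ∘ suc)) Σg≤Σf | i
... | g₀≤f₀ , _     | zero   = g₀≤f₀
... | _     , tail≤ | suc i' = sum-rigid (f≤g ∘ suc) tail≤ i'

sameBlockPairs : ∀ {n} → Partition n → ℕ
sameBlockPairs π = sum λ x → sum λ y → indicator (π x ≟ⁿ π y)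

sameBlockPairs-mono : ∀ {n} {π π' : Partition n} → π ⪯ π' →
  sameBlockPairs π ≤ sameBlockPairs π'
sameBlockPairs-mono {π = π} {π'} π⪯π' =
  sum-mono λ x → sum-mono λ y → indicator-mono (π x ≟ⁿ π y) (π' x ≟ⁿ π' y) (π⪯π' x y)

sameBlockPairs-rigid : ∀ {n} {π π' : Partition n} → π ⪯ π' →
  sameBlockPairs π' ≤ sameBlockPairs π → π' ⪯ π
sameBlockPairs-rigid {π = π} {π'} π⪯π' count x y =
  indicator-reflects (π' x ≟ⁿ π' y) (π x ≟ⁿ π y) (sum-rigid (entry≤ x) (row≤ x) y)
  where
  entry≤ : ∀ x y → indicator (π x ≟ⁿ π y) ≤ indicator (π' x ≟ⁿ π' y)
  entry≤ x y = indicator-mono (π x ≟ⁿ π y) (π' x ≟ⁿ π' y) (π⪯π' x y)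
  row≤ : ∀ x → sum (λ y → indicator (π' x ≟ⁿ π' y)) ≤ sum (λ y → indicator (π x ≟ⁿ π y))
  row≤ = sum-rigid (λ x → sum-mono (entry≤ x)) count

sameBlockPairs-relabel : ∀ {m n} (θ : Fin m ↔ Fin n) (π : Partition n) →
  sameBlockPairs (π ∘ₚ Inverse.to θ) ≡ sameBlockPairs π
sameBlockPairs-relabel θ π = sym (begin
  sum (λ x → sum λ y → indicator (π x ≟ⁿ π y))
    ≡⟨ sum-permute (λ x → sum λ y → indicator (π x ≟ⁿ π y)) θ ⟩
  sum (λ x → sum λ y → indicator (π (θ̂ x) ≟ⁿ π y))
    ≡⟨ sum-cong-≗ (λ x → sum-permute (λ y → indicator (π (θ̂ x) ≟ⁿ π y)) θ) ⟩
  sum (λ x → sum λ y → indicator (π (θ̂ x) ≟ⁿ π (θ̂ y)))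
    ∎)
  where
  open ≡-Reasoning
  θ̂ = Inverse.to θ

totalPairs : ASD → ℕ
totalPairs D = sum (sameBlockPairs ∘ part D)

RefinesVia : (D D' : ASD) → Fin (nS D) ↔ Fin (nS D') → Fin (nP D) ↔ Fin (nP D') → Set
RefinesVia D D' φ α = ∀ i → (part D' (Inverse.to α i) ∘ₚ Inverse.to φ) ⪯ part D i

IsomorphicVia : (D D' : ASD) → Fin (nS D) ↔ Fin (nS D') → Fin (nP D) ↔ Fin (nP D') → Set
IsomorphicVia D D' φ α = ∀ i → part D i ≐ (part D' (Inverse.to α i) ∘ₚ Inverse.to φ)

pulledBack-totalPairs : ∀ {D} D' (φ : Fin (nS D) ↔ Fin (nS D')) (α : Fin (nP D) ↔ Fin (nP D')) →
  sum (λ i → sameBlockPairs (part D' (Inverse.to α i) ∘ₚ Inverse.to φ)) ≡ totalPairs D'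
pulledBack-totalPairs D' φ α = begin
  sum (λ i → sameBlockPairs (part D' (Inverse.to α i) ∘ₚ Inverse.to φ))
    ≡⟨ sum-cong-≗ (λ i → sameBlockPairs-relabel φ (part D' (Inverse.to α i))) ⟩
  sum (λ i → sameBlockPairs (part D' (Inverse.to α i)))
    ≡⟨ sum-permute (sameBlockPairs ∘ part D') α ⟨
  totalPairs D'
    ∎
  where open ≡-Reasoning

refinesVia⇒totalPairs-≥ : ∀ D D' φ α → RefinesVia D D' φ α → totalPairs D' ≤ totalPairs D
refinesVia⇒totalPairs-≥ D D' φ α refines =
  ≤-trans (≤-reflexive (sym (pulledBack-totalPairs {D} D' φ α)))
          (sum-mono λ i → sameBlockPairs-mono (refines i))

refinesVia-rigid : ∀ D D' φ α → RefinesVia D D' φ α → totalPairs D ≤ totalPairs D' →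
  IsomorphicVia D D' φ α
refinesVia-rigid D D' φ α refines D≤D' i x y =
  mk⇔ (sameBlockPairs-rigid (refines i) (counts i) x y) (refines i x y)
  where
  counts : ∀ i → sameBlockPairs (part D i) ≤
                 sameBlockPairs (part D' (Inverse.to α i) ∘ₚ Inverse.to φ)
  counts = sum-rigid (λ i → sameBlockPairs-mono (refines i))
                     (≤-trans D≤D' (≤-reflexive (sym (pulledBack-totalPairs {D} D' φ α))))

minimal-≡D⇒isomorphic : ∀ D D' → Minimal D → Minimal D' → D ≡D D' →
  Σ (Fin (nS D) ↔ Fin (nS D')) λ φ → Σ (Fin (nP D) ↔ Fin (nP D')) λ α → IsomorphicVia D D' φ α
minimal-≡D⇒isomorphic D D' (sminD , pminD) (sminD' , pminD') (le@(φ , α , refines) , ge@(ψ , β , refines')) =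
  φ↔ , α↔ , refinesVia-rigid D D' φ↔ α↔ refines (refinesVia⇒totalPairs-≥ D' D ψ↔ β↔ refines')
  where
  φ-surj = stateMinimal⇒surjective {D} {D'} sminD' le ge
  ψ-surj = stateMinimal⇒surjective {D'} {D} sminD ge le
  α-surj = partitionMinimal⇒surjective {D} {D'} pminD' le ge
  β-surj = partitionMinimal⇒surjective {D'} {D} pminD ge le
  φ↔ = surjections⇒↔ φ φ-surj ψ ψ-surj
  ψ↔ = surjections⇒↔ ψ ψ-surj φ φ-surj
  α↔ = surjections⇒↔ α α-surj β β-surj
  β↔ = surjections⇒↔ β β-surj α α-surj

isomorphicVia-sym : ∀ D D' φ α → IsomorphicVia D D' φ α → IsomorphicVia D' D (↔-sym φ) (↔-sym α)
isomorphicVia-sym D D' φ α iso j x y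
  with iso (Inverse.from α j) (Inverse.from φ x) (Inverse.from φ y)
... | same rewrite Inverse.strictlyInverseˡ α j
                 | Inverse.strictlyInverseˡ φ x
                 | Inverse.strictlyInverseˡ φ y = ⇔-sym same

isomorphic⇒≡D : ∀ D D' φ α → IsomorphicVia D D' φ α → D ≡D D'
isomorphic⇒≡D D D' φ α iso =
  (Inverse.to φ , Inverse.to α , λ i x y → Equivalence.from (iso i x y)) ,
  (Inverse.from φ , Inverse.from α , λ j x y → Equivalence.from (isomorphicVia-sym D D' φ α iso j x y))

proposition2 : (D D' : ASD) → Minimal D → Minimal D' →
    (D ≡D D' ⇔
    Σ (Fin (nS D) ↔ Fin (nS D')) λ φ → Σ (Fin (nP D) ↔ Fin (nP D')) λ α →
    (∀ i → part D i ≐ (part D' (Inverse.to α i) ∘ₚ Inverse.to φ)))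
    ×
    ((φ : Fin (nS D) ↔ Fin (nS D')) → (α : Fin (nP D) ↔ Fin (nP D')) →
    ((∀ i → part D i ≐ (part D' (Inverse.to α i) ∘ₚ Inverse.to φ)) ⇔
    (∀ j → part D' j ≐ (part D (Inverse.from α j) ∘ₚ Inverse.from φ))))
proposition2 D D' minD minD' =
  mk⇔ (minimal-≡D⇒isomorphic D D' minD minD') (λ (φ , α , iso) → isomorphic⇒≡D D D' φ α iso) ,
  λ φ α → mk⇔ (isomorphicVia-sym D D' φ α) (isomorphicVia-sym D' D (↔-sym φ) (↔-sym α))
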